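{- Let $p$ be a prime, $n\ge1$, $R$ an $\mathbb{F}_p$-algebra, $A_{\mu,R}=R[U]/(U^{p^n}-1)$ and $S(A_{\mu,R})_\Theta=R[Y_1,Y_U,\dots,Y_{U^{p^n-1}},1/(Y_1Y_U\cdots Y_{U^{p^n-1}})]$, regarded as a right $A_{\mu,R}$-comodule algebra via the $R$-algebra map $\rho(Y_{U^s})=Y_{U^s}\otimes U^s$. Then its subalgebra of coinvariants is $$S(A_{\mu,R})_\Theta^{\mathrm{co}A_{\mu,R}}=R\Big[Y_1^{\pm1},\Big(\frac{Y_U^2}{Y_{U^2}}\Big)^{\pm1},\dots,\Big(\frac{Y_U^{p^n-1}}{Y_{U^{p^n-1}}}\Big)^{\pm1},(Y_U^{p^n})^{\pm1}\Big].$$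
   Context: $S(A_{\mu,R})_\Theta$ is the coordinate ring of the unit group scheme $U(\mu_{p^n,R})$ of the group algebra of $\mu_{p^n,R}=\mathrm{Spec}\,A_{\mu,R}$ (comultiplication $U\mapsto U\otimes U$), with $Y_{U^s}(f)=f(U^s)$ and $Y_1=Y_{U^0}$; the comodule structure $\rho$ is the one induced by the canonical closed immersion $\mu_{p^n,R}\to U(\mu_{p^n,R})$ (right multiplication). Coinvariants are the elements $b$ with $\rho(b)=b\otimes1$. -}

module Defs where

open import Level using (Level; _⊔_)
open import Algebra.Bundles using (CommutativeRing)
open import Data.Nat as ℕ using (ℕ; zero; suc; NonZero; _≤_; _<_)
open import Data.Nat.Properties using (m^n≢0)
open import Data.Nat.Primality using (Prime; prime⇒nonZero)
open import Data.Integer as ℤ using (ℤ; +_)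
open import Data.Fin as Fin using (Fin; toℕ)
open import Data.Vec as Vec using (Vec; tabulate; zipWith; lookup; foldr)
open import Data.Vec.Properties using (≡-dec)
open import Data.List as List using (List; []; _∷_; _++_; concatMap)
open import Data.Product using (_×_; _,_; Σ; ∃)
open import Relation.Nullary using (yes; no)
open import Relation.Binary.PropositionalEquality using (_≡_)

pow-nonZero : ∀ {p} → Prime p → (n : ℕ) → NonZero (p ℕ.^ n)
pow-nonZero {p} pp n = m^n≢0 p n {{prime⇒nonZero pp}}

module _ {c ℓ} (R : CommutativeRing c ℓ) where
  open CommutativeRing R renaming (Carrier to A)

  natCast : ℕ → A
  natCast zero    = 0#
  natCast (suc k) = 1# + natCast k

  IsFpAlgebra : ℕ → Set ℓ
  IsFpAlgebra p = natCast p ≈ 0#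

  -- Exponent vectors of Laurent monomials Y_1^{e_0} Y_U^{e_1} ... Y_{U^{N-1}}^{e_{N-1}}
  Exp : ℕ → Set
  Exp N = Vec ℤ N

  -- S(A_{μ,R})_Θ = R[Y_{U^s}^{±1} : 0 ≤ s < N] as formal finite R-linear
  -- combinations of Laurent monomials (equality via coefficients, below).
  Laurent : ℕ → Set c
  Laurent N = List (A × Exp N)

  coeff : ∀ {N} → Laurent N → Exp N → A
  coeff [] e = 0#
  coeff ((r , e′) ∷ f) e with ≡-dec ℤ._≟_ e′ e
  ... | yes _ = r + coeff f e
  ... | no  _ = coeff f e

  _≈L_ : ∀ {N} → Laurent N → Laurent N → Set ℓ
  f ≈L g = ∀ e → coeff f e ≈ coeff g e

  _+L_ : ∀ {N} → Laurent N → Laurent N → Laurent N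
  f +L g = f ++ g

  _*L_ : ∀ {N} → Laurent N → Laurent N → Laurent N
  f *L g = concatMap (λ { (r , e) → List.map (λ { (r′ , e′) → (r * r′ , zipWith ℤ._+_ e e′) }) g }) f

  constL : ∀ {N} → A → Laurent N
  constL {N} r = (r , tabulate (λ _ → + 0)) ∷ []

  mono : ∀ {N} → Exp N → Laurent N
  mono e = (1# , e) ∷ []

  δ : ∀ {N} → ℕ → Exp N
  δ s = tabulate (λ i → if-eq (toℕ i) s)
    where
    if-eq : ℕ → ℕ → ℤ
    if-eq a b with a ℕ.≟ b
    ... | yes _ = + 1
    ... | no  _ = + 0

  -- S ⊗_R A_{μ,R}, A_{μ,R} = R[U]/(U^N - 1) free with basis U^k (0 ≤ k < N):
  -- formal R-combinations of Y^e ⊗ U^k.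
  Tensor : ℕ → Set c
  Tensor N = List (A × Exp N × ℕ)

  coeffT : ∀ {N} → Tensor N → Exp N → ℕ → A
  coeffT [] e k = 0#
  coeffT ((r , e′ , k′) ∷ t) e k with ≡-dec ℤ._≟_ e′ e | k′ ℕ.≟ k
  ... | yes _ | yes _ = r + coeffT t e k
  ... | _     | _     = coeffT t e k

  _≈T_ : ∀ {N} → Tensor N → Tensor N → Set ℓ
  t ≈T u = ∀ e k → coeffT t e k ≈ coeffT u e k

  -- U-degree of Y^e under ρ: Σ_s s·e_s, reduced mod N (since U^N = 1)
  udeg : ∀ {N} .{{_ : NonZero N}} → Exp N → ℕ
  udeg {N} e = foldr (λ _ → ℤ)  ℤ._+_ (+ 0) (tabulate (λ i → + toℕ i ℤ.* lookup e i)) ℤ.%ℕ N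

  -- ρ : the R-algebra map with ρ(Y_{U^s}) = Y_{U^s} ⊗ U^s, hence
  -- ρ(Y^e) = Y^e ⊗ U^{Σ s e_s}, extended R-linearly.
  ρ : ∀ {N} .{{_ : NonZero N}} → Laurent N → Tensor N
  ρ f = List.map (λ { (r , e) → (r , e , udeg e) }) f

  _⊗1 : ∀ {N} → Laurent N → Tensor N
  f ⊗1 = List.map (λ { (r , e) → (r , e , 0) }) f

  IsCoinvariant : ∀ {N} .{{_ : NonZero N}} → Laurent N → Set ℓ
  IsCoinvariant f = ρ f ≈T (f ⊗1)

  data Gen (N : ℕ) : Set where
    y1    : Gen N
    ratio : (s : ℕ) → 2 ≤ s → s < N → Gen N
    yUpow : Gen N

  genExp : ∀ {N} → Gen N → Exp N
  genExp y1            = δ 0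
  genExp {N} (ratio s _ _) = zipWith ℤ._-_ (Vec.map (λ x → + s ℤ.* x) (δ 1)) (δ s)
  genExp {N} yUpow     = Vec.map (λ x → + N ℤ.* x) (δ 1)

  data Expr (N : ℕ) : Set c where
    const  : A → Expr N
    gen    : Gen N → Expr N
    genInv : Gen N → Expr N
    _⊕_    : Expr N → Expr N → Expr N
    _⊛_    : Expr N → Expr N → Expr N

  eval : ∀ {N} → Expr N → Laurent N
  eval (const r)  = constL r
  eval (gen g)    = mono (genExp g)
  eval (genInv g) = mono (Vec.map ℤ.-_ (genExp g))
  eval (x ⊕ y)    = eval x +L eval y
  eval (x ⊛ y)    = eval x *L eval y

  InGeneratedSubalgebra : ∀ {N} → Laurent N → Set (c ⊔ ℓ)
  InGeneratedSubalgebra {N} f = Σ (Expr N) (λ x → eval x ≈L f)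

{-# OPTIONS --safe #-}

-- Under ρ the monomial Y^e goes to Y^e ⊗ U^(w e), where w e = Σ s·e_s is its weight.  As
-- U^N = 1 (N = p^n), ρ is a ℤ/N-grading, and f is coinvariant exactly when it is concentrated
-- in degree zero: every monomial of f whose weight is not divisible by N has coefficient 0.
-- The generators have weights 0, s − s = 0 and N, so everything they generate is
-- concentrated in degree zero.  Conversely, if w e = q N then
--   Y^e = Y_1^(e_0) · ∏_{s ≥ 2} (Y_U^s / Y_{U^s})^(−e_s) · (Y_U^N)^q,
-- because the exponents of Y_U on the two sides differ by w e − q N = 0.

module Submission where

open import Defs
open import Algebra.Bundles using (CommutativeRing)
open import Data.Nat using (ℕ; _≤_; _^_)
open import Data.Nat.Primality using (Prime)
open import Data.Product using (_×_)

open import Level using (_⊔_)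
open import Data.Empty using (⊥-elim)
open import Data.Fin using (Fin; toℕ; fromℕ<)
open import Data.Fin.Properties using (toℕ-fromℕ<; toℕ<n)
open import Data.Integer as ℤ using (ℤ; +_; -[1+_]; 0ℤ; 1ℤ; _+_; _*_; -_; _-_; _%ℕ_; _/ℕ_; ∣_∣)
import Data.Integer.Properties as ℤ
open import Data.Integer.DivMod using (a≡a%ℕn+[a/ℕn]*n)
open import Data.Integer.Divisibility.Signed using (_∣_; _∣?_; divides; ∣⇒∣ᵤ; ∣m∣n⇒∣m+n; ∣m⇒∣-m)
open import Data.Integer.Tactic.RingSolver using (solve-∀)
open import Data.List as List using ([]; _∷_; _++_; filter)
open import Data.List.Relation.Unary.All as All using (All; []; _∷_)
open import Data.List.Relation.Unary.All.Properties using (++⁺; map⁺; all-filter)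
open import Data.Nat as ℕ using (zero; suc; _<_)
import Data.Nat.Properties as ℕ
open import Data.Nat.Divisibility using (n∣m⇒m%n≡0)
open import Data.Product using (_,_; proj₂)
open import Data.Vec using (Vec; lookup; tabulate; foldr; zipWith; map)
open import Data.Vec.Properties
  using (≡-dec; lookup-zipWith; lookup-map; lookup∘tabulate; tabulate∘lookup; tabulate-cong)
open import Function.Base using (_∘_; _∋_)
open import Function.Bundles using (_⇔_; mk⇔; Equivalence)
import Function.Properties.Equivalence as ⇔
open import Relation.Binary.PropositionalEquality
  using (_≡_; _≢_; _≗_; refl; sym; trans; cong; cong₂; subst; module ≡-Reasoning)
import Relation.Binary.Reasoning.Setoid as ≈-Reasoning
open import Relation.Nullary using (¬_; yes; no; contradiction)
open import Relation.Unary using (Decidable)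

open import Algebra.Properties.Semiring.Sum ℤ.+-*-semiring
  using (sum-syntax; ∑-distrib-+; *-distribˡ-sum; *-distribʳ-sum; sum-cong-≗; sum-replicate-zero)


kronecker : ℕ → ℕ → ℤ
kronecker zero    zero    = 1ℤ
kronecker zero    (suc _) = 0ℤ
kronecker (suc _) zero    = 0ℤ
kronecker (suc a) (suc b) = kronecker a b

kronecker-refl : ∀ a → kronecker a a ≡ 1ℤ
kronecker-refl zero    = refl
kronecker-refl (suc a) = kronecker-refl a

kronecker-≢ : ∀ {a b} → a ≢ b → kronecker a b ≡ 0ℤ
kronecker-≢ {zero}  {zero}  a≢b = ⊥-elim (a≢b refl)
kronecker-≢ {zero}  {suc _} _   = refl
kronecker-≢ {suc _} {zero}  _   = refl
kronecker-≢ {suc a} {suc b} a≢b = kronecker-≢ (a≢b ∘ cong suc)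

kronecker-sym : ∀ a b → kronecker a b ≡ kronecker b a
kronecker-sym zero    zero    = refl
kronecker-sym zero    (suc _) = refl
kronecker-sym (suc _) zero    = refl
kronecker-sym (suc a) (suc b) = kronecker-sym a b

∑-kronecker : ∀ {n} (f : Fin n → ℤ) (j : Fin n) → ∑[ i < n ] (f i * kronecker (toℕ i) (toℕ j)) ≡ f j
∑-kronecker {suc n} f Fin.zero = begin
  f Fin.zero * 1ℤ + ∑[ i < n ] (f (Fin.suc i) * 0ℤ) ≡⟨ cong₂ _+_ (ℤ.*-identityʳ (f Fin.zero)) ∑0 ⟩
  f Fin.zero + 0ℤ                                  ≡⟨ ℤ.+-identityʳ (f Fin.zero) ⟩
  f Fin.zero                                       ∎
  where
  open ≡-Reasoning
  ∑0 : ∑[ i < n ] (f (Fin.suc i) * 0ℤ) ≡ 0ℤ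
  ∑0 = trans (sum-cong-≗ (ℤ.*-zeroʳ ∘ f ∘ Fin.suc)) (sum-replicate-zero n)
∑-kronecker {suc n} f (Fin.suc j) =
  trans (cong₂ _+_ (ℤ.*-zeroʳ (f Fin.zero)) (∑-kronecker (f ∘ Fin.suc) j)) (ℤ.+-identityˡ (f (Fin.suc j)))

∑-neg : ∀ {n} (f : Fin n → ℤ) → ∑[ i < n ] (- f i) ≡ - ∑[ i < n ] f i
∑-neg {zero}  f = refl
∑-neg {suc n} f = trans (cong (λ t → - f Fin.zero + t) (∑-neg (f ∘ Fin.suc)))
                        (sym (ℤ.neg-distrib-+ (f Fin.zero) (∑[ i < n ] f (Fin.suc i))))

foldr-+-tabulate : ∀ {n} (f : Fin n → ℤ) → foldr (λ _ → ℤ) _+_ 0ℤ (tabulate f) ≡ ∑[ i < n ] f i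
foldr-+-tabulate {zero}  f = refl
foldr-+-tabulate {suc n} f = cong (λ t → f Fin.zero + t) (foldr-+-tabulate (f ∘ Fin.suc))

%ℕ≡0⇒∣ : ∀ i n .{{_ : ℕ.NonZero n}} → i %ℕ n ≡ 0 → + n ∣ i
%ℕ≡0⇒∣ i n i%n≡0 = divides (i /ℕ n) (begin
  i                              ≡⟨ a≡a%ℕn+[a/ℕn]*n i n ⟩
  + (i %ℕ n) + (i /ℕ n) * + n    ≡⟨ cong (λ r → + r + (i /ℕ n) * + n) i%n≡0 ⟩
  0ℤ + (i /ℕ n) * + n            ≡⟨ ℤ.+-identityˡ _ ⟩
  (i /ℕ n) * + n                 ∎)
  where open ≡-Reasoning

∣⇒%ℕ≡0 : ∀ i n .{{_ : ℕ.NonZero n}} → + n ∣ i → i %ℕ n ≡ 0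
∣⇒%ℕ≡0 i n n∣i = %ℕ≡0-from-abs i (n∣m⇒m%n≡0 _ n (∣⇒∣ᵤ n∣i))
  where
  %ℕ≡0-from-abs : ∀ i → ∣ i ∣ ℕ.% n ≡ 0 → i %ℕ n ≡ 0
  %ℕ≡0-from-abs (+ m) h = h
  %ℕ≡0-from-abs -[1+ m ] h with suc m ℕ.% n
  ... | zero = refl
  %ℕ≡0-from-abs -[1+ m ] () | suc _

weight : ∀ {N} → Vec ℤ N → ℤ
weight {N} e = ∑[ i < N ] (+ toℕ i * lookup e i)

module _ {N : ℕ} where
  open ≡-Reasoning

  weight-≗ : ∀ (e : Vec ℤ N) {φ : Fin N → ℤ} → lookup e ≗ φ → weight e ≡ ∑[ i < N ] (+ toℕ i * φ i)
  weight-≗ _ e≗φ = sum-cong-≗ {N} (λ i → cong (λ t → + toℕ i * t) (e≗φ i))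

  weight-zero : weight (tabulate {n = N} (λ _ → 0ℤ)) ≡ 0ℤ
  weight-zero = begin
    weight zero-vector         ≡⟨ weight-≗ zero-vector (lookup∘tabulate (λ _ → 0ℤ)) ⟩
    ∑[ i < N ] (+ toℕ i * 0ℤ)  ≡⟨ sum-cong-≗ {N} (λ i → ℤ.*-zeroʳ (+ toℕ i)) ⟩
    ∑[ i < N ] 0ℤ              ≡⟨ sum-replicate-zero N ⟩
    0ℤ                         ∎
    where
    zero-vector : Vec ℤ N
    zero-vector = tabulate (λ _ → 0ℤ)

  weight-zipWith-+ : ∀ (a b : Vec ℤ N) → weight (zipWith _+_ a b) ≡ weight a + weight b
  weight-zipWith-+ a b = begin
    weight (zipWith _+_ a b)
      ≡⟨ weight-≗ (zipWith _+_ a b) (λ i → lookup-zipWith _+_ i a b) ⟩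
    ∑[ i < N ] (+ toℕ i * (lookup a i + lookup b i))
      ≡⟨ sum-cong-≗ {N} (λ i → ℤ.*-distribˡ-+ (+ toℕ i) (lookup a i) (lookup b i)) ⟩
    ∑[ i < N ] (+ toℕ i * lookup a i + + toℕ i * lookup b i)
      ≡⟨ ∑-distrib-+ (λ i → + toℕ i * lookup a i) (λ i → + toℕ i * lookup b i) ⟩
    weight a + weight b ∎

  weight-map-neg : ∀ (a : Vec ℤ N) → weight (map -_ a) ≡ - weight a
  weight-map-neg a = begin
    weight (map -_ a)
      ≡⟨ weight-≗ (map -_ a) (λ i → lookup-map i -_ a) ⟩
    ∑[ i < N ] (+ toℕ i * - lookup a i)
      ≡⟨ sum-cong-≗ {N} (λ i → ℤ.neg-distribʳ-* (+ toℕ i) (lookup a i)) ⟨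
    ∑[ i < N ] (- (+ toℕ i * lookup a i))
      ≡⟨ ∑-neg (λ i → + toℕ i * lookup a i) ⟩
    - weight a ∎

  weight-zipWith-- : ∀ (a b : Vec ℤ N) → weight (zipWith _-_ a b) ≡ weight a - weight b
  weight-zipWith-- a b = begin
    weight (zipWith _-_ a b)
      ≡⟨ weight-≗ (zipWith _-_ a b) (λ i → lookup-zipWith _-_ i a b) ⟩
    ∑[ i < N ] (+ toℕ i * (lookup a i - lookup b i))
      ≡⟨ sum-cong-≗ {N} (λ i → distrib (+ toℕ i) (lookup a i) (lookup b i)) ⟩
    ∑[ i < N ] (+ toℕ i * lookup a i + - (+ toℕ i * lookup b i))
      ≡⟨ ∑-distrib-+ (λ i → + toℕ i * lookup a i) (λ i → - (+ toℕ i * lookup b i)) ⟩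
    weight a + ∑[ i < N ] (- (+ toℕ i * lookup b i))
      ≡⟨ cong (λ t → weight a + t) (∑-neg (λ i → + toℕ i * lookup b i)) ⟩
    weight a - weight b ∎
    where
    distrib : ∀ i x y → i * (x - y) ≡ i * x + - (i * y)
    distrib = solve-∀

  weight-map-* : ∀ k (a : Vec ℤ N) → weight (map (k *_) a) ≡ k * weight a
  weight-map-* k a = begin
    weight (map (k *_) a)
      ≡⟨ weight-≗ (map (k *_) a) (λ i → lookup-map i (k *_) a) ⟩
    ∑[ i < N ] (+ toℕ i * (k * lookup a i))
      ≡⟨ sum-cong-≗ {N} (λ i → swap (+ toℕ i) k (lookup a i)) ⟩
    ∑[ i < N ] (k * (+ toℕ i * lookup a i))
      ≡⟨ *-distribˡ-sum k (λ i → + toℕ i * lookup a i) ⟨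
    k * weight a ∎
    where
    swap : ∀ i k x → i * (k * x) ≡ k * (i * x)
    swap = solve-∀

module _ {c ℓ} (R : CommutativeRing c ℓ) {N : ℕ} where
  open CommutativeRing R
    using (_≈_; 0#; 1#; setoid; +-cong; +-congˡ; +-congʳ; +-assoc; +-identityˡ; +-identityʳ;
           *-cong; *-identityˡ; *-identityʳ)
    renaming (Carrier to A; _+_ to _+ᴿ_; _*_ to _*ᴿ_; refl to ≈-refl; sym to ≈-sym; trans to ≈-trans)

  lookup-δ : ∀ s (j : Fin N) → lookup (δ R s) j ≡ kronecker (toℕ j) s
  lookup-δ s j rewrite (lookup (δ R s) j ≡ _ ∋ lookup∘tabulate _ j) with toℕ j ℕ.≟ s
  ... | yes refl = sym (kronecker-refl (toℕ j))
  ... | no  j≢s  = sym (kronecker-≢ j≢s)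

  lookup-ratio : ∀ {s} (2≤s : 2 ℕ.≤ s) (s<N : s < N) (j : Fin N) →
                 lookup (genExp R (ratio s 2≤s s<N)) j ≡ + s * kronecker (toℕ j) 1 - kronecker (toℕ j) s
  lookup-ratio {s} _ _ j =
    trans (lookup-zipWith _-_ j (map (+ s *_) (δ R 1)) (δ R s))
          (cong₂ _-_ (trans (lookup-map j (+ s *_) (δ R 1)) (cong (+ s *_) (lookup-δ 1 j))) (lookup-δ s j))

  lookup-yUpow : ∀ (j : Fin N) → lookup (genExp R yUpow) j ≡ + N * kronecker (toℕ j) 1
  lookup-yUpow j = trans (lookup-map j (+ N *_) (δ R 1)) (cong (+ N *_) (lookup-δ 1 j))

  weight-δ : ∀ {s} → s < N → weight (δ R {N} s) ≡ + s
  weight-δ {s} s<N = begin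
    weight (δ R {N} s)
      ≡⟨ weight-≗ (δ R {N} s) (λ i → trans (lookup-δ s i) (cong (kronecker (toℕ i)) (sym j≡s))) ⟩
    ∑[ i < N ] (+ toℕ i * kronecker (toℕ i) (toℕ (fromℕ< s<N)))
      ≡⟨ ∑-kronecker (λ i → + toℕ i) (fromℕ< s<N) ⟩
    + toℕ (fromℕ< s<N)
      ≡⟨ cong +_ j≡s ⟩
    + s ∎
    where
    open ≡-Reasoning
    j≡s : toℕ (fromℕ< s<N) ≡ s
    j≡s = toℕ-fromℕ< s<N

  DegreeZero : Exp R N → Set
  DegreeZero e = + N ∣ weight e

  degreeZero? : Decidable DegreeZero
  degreeZero? e = + N ∣? weight e

  degreeZero-zero : DegreeZero (tabulate (λ _ → 0ℤ))
  degreeZero-zero = divides 0ℤ (weight-zero {N})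

  degreeZero-zipWith-+ : ∀ {a b} → DegreeZero a → DegreeZero b → DegreeZero (zipWith _+_ a b)
  degreeZero-zipWith-+ {a} {b} da db = subst (+ N ∣_) (sym (weight-zipWith-+ a b)) (∣m∣n⇒∣m+n da db)

  degreeZero-map-neg : ∀ {a} → DegreeZero a → DegreeZero (map -_ a)
  degreeZero-map-neg {a} da = subst (+ N ∣_) (sym (weight-map-neg a)) (∣m⇒∣-m da)

  AllDegreeZero : Laurent R N → Set c
  AllDegreeZero = All (DegreeZero ∘ proj₂)

  *L-allDegreeZero : ∀ {f g} → AllDegreeZero f → AllDegreeZero g → AllDegreeZero (_*L_ R f g)
  *L-allDegreeZero []         _   = []
  *L-allDegreeZero {(_ , e) ∷ _} (dz ∷ dzf) dzg =
    ++⁺ (map⁺ (All.map (λ {t} → degreeZero-zipWith-+ {e} {proj₂ t} dz) dzg)) (*L-allDegreeZero dzf dzg)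

  ConcentratedInDegreeZero : Laurent R N → Set ℓ
  ConcentratedInDegreeZero f = ∀ e → ¬ DegreeZero e → coeff R f e ≈ 0#

  coeff-++ : ∀ (f g : Laurent R N) e → coeff R (f ++ g) e ≈ coeff R f e +ᴿ coeff R g e
  coeff-++ []             g e = ≈-sym (+-identityˡ _)
  coeff-++ ((r , e′) ∷ f) g e with ≡-dec ℤ._≟_ e′ e
  ... | yes _ = ≈-trans (+-congˡ (coeff-++ f g e)) (≈-sym (+-assoc r _ _))
  ... | no  _ = coeff-++ f g e

  coeff-singleton-cong : ∀ {r s} (v e : Exp R N) → r ≈ s →
                         coeff R ((r , v) ∷ []) e ≈ coeff R ((s , v) ∷ []) e
  coeff-singleton-cong v e r≈s with ≡-dec ℤ._≟_ v e
  ... | yes _ = +-congʳ r≈s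
  ... | no  _ = ≈-refl

  coeff-outside-support : ∀ {P : Exp R N → Set} {f e} → All (P ∘ proj₂) f → ¬ P e → coeff R f e ≈ 0#
  coeff-outside-support                          []         ¬pe = ≈-refl
  coeff-outside-support {f = (_ , e′) ∷ _} {e} (pe′ ∷ ps) ¬pe with ≡-dec ℤ._≟_ e′ e
  ... | yes refl = contradiction pe′ ¬pe
  ... | no  _    = coeff-outside-support ps ¬pe

  coeff-filter : ∀ {P : Exp R N → Set} (P? : Decidable P) f {e} → P e →
                 coeff R (filter (P? ∘ proj₂) f) e ≈ coeff R f e
  coeff-filter P? []             pe = ≈-refl
  coeff-filter P? ((r , e′) ∷ f) {e} pe with P? e′
  ... | yes _ with ≡-dec ℤ._≟_ e′ e
  ...   | yes _ = +-congˡ (coeff-filter P? f pe)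
  ...   | no  _ = coeff-filter P? f pe
  coeff-filter P? ((r , e′) ∷ f) {e} pe | no ¬pe′ with ≡-dec ℤ._≟_ e′ e
  ... | yes refl = contradiction pe ¬pe′
  ... | no  _    = coeff-filter P? f pe

  -- ρ R and _⊗1 R are, definitionally, graded (udeg R) and graded (λ _ → 0).
  graded : (Exp R N → ℕ) → Laurent R N → Tensor R N
  graded d = List.map (λ (r , e) → r , e , d e)

  coeffT-graded-≡ : ∀ d f {e k} → d e ≡ k → coeffT R (graded d f) e k ≈ coeff R f e
  coeffT-graded-≡ d []             de≡k = ≈-refl
  coeffT-graded-≡ d ((r , e′) ∷ f) {e} {k} de≡k with ≡-dec ℤ._≟_ e′ e | d e′ ℕ.≟ k
  ... | yes refl | yes _    = +-congˡ (coeffT-graded-≡ d f de≡k)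
  ... | yes refl | no  de≢k = contradiction de≡k de≢k
  ... | no  _    | _        = coeffT-graded-≡ d f de≡k

  coeffT-graded-≢ : ∀ d f {e k} → d e ≢ k → coeffT R (graded d f) e k ≈ 0#
  coeffT-graded-≢ d []             de≢k = ≈-refl
  coeffT-graded-≢ d ((r , e′) ∷ f) {e} {k} de≢k with ≡-dec ℤ._≟_ e′ e | d e′ ℕ.≟ k
  ... | yes refl | yes de≡k = contradiction de≡k de≢k
  ... | yes refl | no  _    = coeffT-graded-≢ d f de≢k
  ... | no  _    | _        = coeffT-graded-≢ d f de≢k

  coeffT-graded-cong : ∀ d d′ f {e k} → d e ≡ d′ e →
                       coeffT R (graded d f) e k ≈ coeffT R (graded d′ f) e k
  coeffT-graded-cong d d′ f {e} {k} de≡d′e with d e ℕ.≟ k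
  ... | yes de≡k = ≈-trans (coeffT-graded-≡ d f de≡k)
                           (≈-sym (coeffT-graded-≡ d′ f (trans (sym de≡d′e) de≡k)))
  ... | no  de≢k = ≈-trans (coeffT-graded-≢ d f de≢k)
                           (≈-sym (coeffT-graded-≢ d′ f (de≢k ∘ trans de≡d′e)))

  coeffT-graded-zero : ∀ d f {e k} → coeff R f e ≈ 0# → coeffT R (graded d f) e k ≈ 0#
  coeffT-graded-zero d f {e} {k} fe≈0 with d e ℕ.≟ k
  ... | yes de≡k = ≈-trans (coeffT-graded-≡ d f de≡k) fe≈0
  ... | no  de≢k = coeffT-graded-≢ d f de≢k

  -- eval multiplies coefficients, so the coefficient of a term is only known up to ≈.
  record IsTerm (x : Expr R N) (r : A) (φ : Fin N → ℤ) : Set (c ⊔ ℓ) where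
    constructor mkIsTerm
    field
      coefficient     : A
      exponent        : Exp R N
      eval≡           : eval R x ≡ (coefficient , exponent) ∷ []
      coefficient≈    : coefficient ≈ r
      lookup-exponent : lookup exponent ≗ φ

  isTerm-cong : ∀ {x r s φ ψ} → r ≈ s → φ ≗ ψ → IsTerm x r φ → IsTerm x s ψ
  isTerm-cong r≈s φ≗ψ (mkIsTerm r′ v eval≡ r′≈r v≗φ) =
    mkIsTerm r′ v eval≡ (≈-trans r′≈r r≈s) (λ j → trans (v≗φ j) (φ≗ψ j))

  isTerm⇒≈L : ∀ {x r e} → IsTerm x r (lookup e) → _≈L_ R (eval R x) ((r , e) ∷ [])
  isTerm⇒≈L {x} {r} {e} (mkIsTerm r′ v eval≡ r′≈r v≗e) e″ = begin
    coeff R (eval R x) e″       ≡⟨ cong (λ l → coeff R l e″) (trans eval≡ (cong (λ u → (r′ , u) ∷ []) v≡e)) ⟩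
    coeff R ((r′ , e) ∷ []) e″  ≈⟨ coeff-singleton-cong e e″ r′≈r ⟩
    coeff R ((r , e) ∷ []) e″   ∎
    where
    open ≈-Reasoning setoid
    v≡e : v ≡ e
    v≡e = trans (sym (tabulate∘lookup v)) (trans (tabulate-cong v≗e) (tabulate∘lookup e))

  isTerm-const : ∀ r → IsTerm (const r) r (λ _ → 0ℤ)
  isTerm-const r = mkIsTerm r (tabulate (λ _ → 0ℤ)) refl ≈-refl (lookup∘tabulate (λ _ → 0ℤ))

  isTerm-gen : ∀ g → IsTerm (gen g) 1# (lookup (genExp R g))
  isTerm-gen g = mkIsTerm 1# (genExp R g) refl ≈-refl (λ _ → refl)

  isTerm-genInv : ∀ g → IsTerm (genInv g) 1# (λ j → - lookup (genExp R g) j)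
  isTerm-genInv g = mkIsTerm 1# (map -_ (genExp R g)) refl ≈-refl (λ j → lookup-map j -_ (genExp R g))

  isTerm-⊛ : ∀ {x y r s φ ψ} → IsTerm x r φ → IsTerm y s ψ →
             IsTerm (x ⊛ y) (r *ᴿ s) (λ j → φ j + ψ j)
  isTerm-⊛ (mkIsTerm r′ v eval≡x r′≈r v≗φ) (mkIsTerm s′ w eval≡y s′≈s w≗ψ) =
    mkIsTerm (r′ *ᴿ s′) (zipWith _+_ v w) (cong₂ (_*L_ R) eval≡x eval≡y) (*-cong r′≈r s′≈s)
             (λ j → trans (lookup-zipWith _+_ j v w) (cong₂ _+_ (v≗φ j) (w≗ψ j)))

  pow : Expr R N → ℕ → Expr R N
  pow x zero    = const 1#
  pow x (suc m) = x ⊛ pow x m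

  isTerm-pow : ∀ {x φ} → IsTerm x 1# φ → ∀ m → IsTerm (pow x m) 1# (λ j → + m * φ j)
  isTerm-pow t zero            = isTerm-const 1#
  isTerm-pow {φ = φ} t (suc m) =
    isTerm-cong (*-identityˡ 1#) (λ j → sym (ℤ.suc-* (+ m) (φ j))) (isTerm-⊛ t (isTerm-pow t m))

  genPow : Gen R N → ℤ → Expr R N
  genPow g (+ m)    = pow (gen g) m
  genPow g -[1+ m ] = pow (genInv g) (suc m)

  isTerm-genPow : ∀ g k → IsTerm (genPow g k) 1# (λ j → k * lookup (genExp R g) j)
  isTerm-genPow g (+ m)    = isTerm-pow (isTerm-gen g) m
  isTerm-genPow g -[1+ m ] =
    isTerm-cong ≈-refl (λ j → neg-swap (+ suc m) (lookup (genExp R g) j)) (isTerm-pow (isTerm-genInv g) (suc m))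
    where
    neg-swap : ∀ k x → k * - x ≡ - k * x
    neg-swap = solve-∀

  ∏ : ∀ M → (Fin M → Expr R N) → Expr R N
  ∏ zero    x = const 1#
  ∏ (suc M) x = x Fin.zero ⊛ ∏ M (x ∘ Fin.suc)

  isTerm-∏ : ∀ M {x : Fin M → Expr R N} {φ : Fin M → Fin N → ℤ} →
             (∀ i → IsTerm (x i) 1# (φ i)) → IsTerm (∏ M x) 1# (λ j → ∑[ i < M ] φ i j)
  isTerm-∏ zero    _  = isTerm-const 1#
  isTerm-∏ (suc M) ts =
    isTerm-cong (*-identityˡ 1#) (λ _ → refl) (isTerm-⊛ (ts Fin.zero) (isTerm-∏ M (ts ∘ Fin.suc)))

  -- factor s k is Y_{U^s}^k · Y_U^(-s k); for s ≥ 2 it is the power (Y_U^s / Y_{U^s})^(-k).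
  factor : ∀ s → s < N → ℤ → Expr R N
  factor zero          _   k = genPow y1 k
  factor (suc zero)    _   _ = const 1#
  factor (suc (suc s)) s<N k = genPow (ratio (suc (suc s)) (ℕ.s≤s (ℕ.s≤s ℕ.z≤n)) s<N) (- k)

  isTerm-factor : ∀ s (s<N : s < N) k →
                  IsTerm (factor s s<N k) 1# (λ j → k * kronecker (toℕ j) s - (+ s * k) * kronecker (toℕ j) 1)
  isTerm-factor zero _ k =
    isTerm-cong ≈-refl (λ j → trans (cong (k *_) (lookup-δ 0 j)) (sym (ℤ.+-identityʳ _))) (isTerm-genPow y1 k)
  isTerm-factor (suc zero) _ k =
    isTerm-cong ≈-refl (λ j → exponent (kronecker (toℕ j) 1)) (isTerm-const 1#)
    where
    exponent : ∀ a → 0ℤ ≡ k * a - (1ℤ * k) * a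
    exponent a = sym (trans (cong (λ t → k * a - t * a) (ℤ.*-identityˡ k)) (ℤ.+-inverseʳ (k * a)))
  isTerm-factor (suc (suc s)) s<N k =
    isTerm-cong ≈-refl (λ j → trans (cong (- k *_) (lookup-ratio 2≤s s<N j))
                                    (exponent k (+ S) (kronecker (toℕ j) 1) (kronecker (toℕ j) S)))
                (isTerm-genPow (ratio S 2≤s s<N) (- k))
    where
    S = suc (suc s)
    2≤s = ℕ.s≤s (ℕ.s≤s ℕ.z≤n)
    exponent : ∀ k s a b → - k * (s * a - b) ≡ k * b - (s * k) * a
    exponent = solve-∀

  ∑-factor-exponents : ∀ (e : Exp R N) (j : Fin N) →
    ∑[ i < N ] (lookup e i * kronecker (toℕ j) (toℕ i) - (+ toℕ i * lookup e i) * kronecker (toℕ j) 1)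
    ≡ lookup e j - weight e * kronecker (toℕ j) 1
  ∑-factor-exponents e j = begin
    ∑[ i < N ] (eᵢδᵢ i - wᵢ i * κ₁)
      ≡⟨ ∑-distrib-+ eᵢδᵢ (λ i → - (wᵢ i * κ₁)) ⟩
    ∑[ i < N ] eᵢδᵢ i + ∑[ i < N ] (- (wᵢ i * κ₁))
      ≡⟨ cong₂ _+_ ∑eᵢδᵢ (∑-neg (λ i → wᵢ i * κ₁)) ⟩
    lookup e j - ∑[ i < N ] (wᵢ i * κ₁)
      ≡⟨ cong (λ t → lookup e j - t) (*-distribʳ-sum κ₁ wᵢ) ⟨
    lookup e j - weight e * κ₁ ∎
    where
    open ≡-Reasoning
    κ₁ = kronecker (toℕ j) 1
    wᵢ eᵢδᵢ : Fin N → ℤ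
    wᵢ i = + toℕ i * lookup e i
    eᵢδᵢ i = lookup e i * kronecker (toℕ j) (toℕ i)
    ∑eᵢδᵢ : ∑[ i < N ] eᵢδᵢ i ≡ lookup e j
    ∑eᵢδᵢ = trans (sum-cong-≗ {N} (λ i → cong (lookup e i *_) (kronecker-sym (toℕ j) (toℕ i))))
                  (∑-kronecker (lookup e) j)

  monomial : ∀ e → DegreeZero e → Expr R N
  monomial e (divides q _) = ∏ N (λ i → factor (toℕ i) (toℕ<n i) (lookup e i)) ⊛ genPow yUpow q

  isTerm-monomial : ∀ e (dz : DegreeZero e) → IsTerm (monomial e dz) 1# (lookup e)
  isTerm-monomial e (divides q weight≡qN) =
    isTerm-cong (*-identityˡ 1#) exponent
      (isTerm-⊛ (isTerm-∏ N (λ i → isTerm-factor (toℕ i) (toℕ<n i) (lookup e i))) (isTerm-genPow yUpow q))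
    where
    cancel : ∀ a q n c → a - q * n * c + q * (n * c) ≡ a
    cancel = solve-∀
    exponentᵢ : Fin N → Fin N → ℤ
    exponentᵢ i j = lookup e i * kronecker (toℕ j) (toℕ i) - (+ toℕ i * lookup e i) * kronecker (toℕ j) 1
    exponent : ∀ j → ∑[ i < N ] exponentᵢ i j + q * lookup (genExp R yUpow) j ≡ lookup e j
    exponent j = begin
      ∑[ i < N ] exponentᵢ i j + q * lookup (genExp R yUpow) j
        ≡⟨ cong₂ _+_ (∑-factor-exponents e j) (cong (q *_) (lookup-yUpow j)) ⟩
      lookup e j - weight e * κ₁ + q * (+ N * κ₁)
        ≡⟨ cong (λ w → lookup e j - w * κ₁ + q * (+ N * κ₁)) weight≡qN ⟩
      lookup e j - q * + N * κ₁ + q * (+ N * κ₁)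
        ≡⟨ cancel (lookup e j) q (+ N) κ₁ ⟩
      lookup e j ∎
      where
      open ≡-Reasoning
      κ₁ = kronecker (toℕ j) 1

  represent : ∀ f → AllDegreeZero f → Expr R N
  represent []            []         = const 0#
  represent ((r , e) ∷ f) (dz ∷ dzs) = (const r ⊛ monomial e dz) ⊕ represent f dzs

  eval-represent : ∀ f (dzs : AllDegreeZero f) → _≈L_ R (eval R (represent f dzs)) f
  eval-represent [] [] e with ≡-dec ℤ._≟_ (tabulate {n = N} (λ _ → 0ℤ)) e
  ... | yes _ = +-identityʳ 0#
  ... | no  _ = ≈-refl
  eval-represent ((r , e) ∷ f) (dz ∷ dzs) e″ = begin
    coeff R (eval R term ++ eval R (represent f dzs)) e″
      ≈⟨ coeff-++ (eval R term) _ e″ ⟩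
    coeff R (eval R term) e″ +ᴿ coeff R (eval R (represent f dzs)) e″
      ≈⟨ +-cong (isTerm⇒≈L {e = e} isTerm-term e″) (eval-represent f dzs e″) ⟩
    coeff R ((r , e) ∷ []) e″ +ᴿ coeff R f e″
      ≈⟨ coeff-++ ((r , e) ∷ []) f e″ ⟨
    coeff R ((r , e) ∷ f) e″ ∎
    where
    open ≈-Reasoning setoid
    term = const r ⊛ monomial e dz
    isTerm-term : IsTerm term r (lookup e)
    isTerm-term = isTerm-cong (*-identityʳ r) (λ j → ℤ.+-identityˡ (lookup e j))
                              (isTerm-⊛ (isTerm-const r) (isTerm-monomial e dz))

  concentrated⇒generated : ∀ {f} → ConcentratedInDegreeZero f → InGeneratedSubalgebra R f
  concentrated⇒generated {f} conc =
    represent f₀ (all-filter (degreeZero? ∘ proj₂) f) , λ e → ≈-trans (eval-represent f₀ _ e) (f₀≈f e)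
    where
    f₀ = filter (degreeZero? ∘ proj₂) f
    f₀≈f : _≈L_ R f₀ f
    f₀≈f e with degreeZero? e
    ... | yes dz = coeff-filter degreeZero? f dz
    ... | no ¬dz = ≈-trans (coeff-outside-support (all-filter (degreeZero? ∘ proj₂) f) ¬dz)
                           (≈-sym (conc e ¬dz))

  module _ .{{_ : ℕ.NonZero N}} where

    udeg≡weight%ℕ : ∀ e → udeg R e ≡ weight e %ℕ N
    udeg≡weight%ℕ e = cong (_%ℕ N) (foldr-+-tabulate (λ i → + toℕ i * lookup e i))

    udeg≡0⇒degreeZero : ∀ {e} → udeg R e ≡ 0 → DegreeZero e
    udeg≡0⇒degreeZero {e} udeg≡0 = %ℕ≡0⇒∣ (weight e) N (trans (sym (udeg≡weight%ℕ e)) udeg≡0)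

    degreeZero⇒udeg≡0 : ∀ {e} → DegreeZero e → udeg R e ≡ 0
    degreeZero⇒udeg≡0 {e} dz = trans (udeg≡weight%ℕ e) (∣⇒%ℕ≡0 (weight e) N dz)

    coinvariant⇔concentrated : ∀ f → IsCoinvariant R f ⇔ ConcentratedInDegreeZero f
    coinvariant⇔concentrated f = mk⇔ coinvariant⇒concentrated concentrated⇒coinvariant
      where
      coinvariant⇒concentrated : IsCoinvariant R f → ConcentratedInDegreeZero f
      coinvariant⇒concentrated ρf≈f⊗1 e ¬dz = begin
        coeff R f e                      ≈⟨ coeffT-graded-≡ (udeg R) f refl ⟨
        coeffT R (ρ R f) e (udeg R e)    ≈⟨ ρf≈f⊗1 e (udeg R e) ⟩
        coeffT R (_⊗1 R f) e (udeg R e)  ≈⟨ coeffT-graded-≢ (λ _ → 0) f 0≢udeg ⟩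
        0#                               ∎
        where
        open ≈-Reasoning setoid
        0≢udeg : 0 ≢ udeg R e
        0≢udeg = ¬dz ∘ udeg≡0⇒degreeZero {e} ∘ sym

      concentrated⇒coinvariant : ConcentratedInDegreeZero f → IsCoinvariant R f
      concentrated⇒coinvariant conc e k with degreeZero? e
      ... | yes dz = coeffT-graded-cong (udeg R) (λ _ → 0) f (degreeZero⇒udeg≡0 {e} dz)
      ... | no ¬dz = ≈-trans (coeffT-graded-zero (udeg R) f (conc e ¬dz))
                             (≈-sym (coeffT-graded-zero (λ _ → 0) f (conc e ¬dz)))

    degreeZero-genExp : ∀ g → DegreeZero (genExp R g)
    degreeZero-genExp y1 = divides 0ℤ (weight-δ (ℕ.>-nonZero⁻¹ N))
    degreeZero-genExp (ratio s 2≤s s<N) = divides 0ℤ (begin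
      weight (zipWith _-_ (map (+ s *_) δ₁) δₛ) ≡⟨ weight-zipWith-- (map (+ s *_) δ₁) δₛ ⟩
      weight (map (+ s *_) δ₁) - weight δₛ     ≡⟨ cong₂ _-_ (weight-map-* (+ s) δ₁) (weight-δ s<N) ⟩
      + s * weight δ₁ - + s                    ≡⟨ cong (λ t → + s * t - + s) (weight-δ 1<N) ⟩
      + s * 1ℤ - + s                           ≡⟨ cong (_- + s) (ℤ.*-identityʳ (+ s)) ⟩
      + s - + s                                ≡⟨ ℤ.+-inverseʳ (+ s) ⟩
      0ℤ                                       ∎)
      where
      open ≡-Reasoning
      δ₁ δₛ : Exp R N
      δ₁ = δ R 1
      δₛ = δ R s
      1<N = ℕ.<-trans 2≤s s<N
    degreeZero-genExp yUpow =
      divides (weight δ₁) (trans (weight-map-* (+ N) δ₁) (ℤ.*-comm (+ N) (weight δ₁)))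
      where
      δ₁ : Exp R N
      δ₁ = δ R 1

    eval-allDegreeZero : ∀ x → AllDegreeZero (eval R x)
    eval-allDegreeZero (const _)  = degreeZero-zero ∷ []
    eval-allDegreeZero (gen g)    = degreeZero-genExp g ∷ []
    eval-allDegreeZero (genInv g) = degreeZero-map-neg {genExp R g} (degreeZero-genExp g) ∷ []
    eval-allDegreeZero (x ⊕ y)    = ++⁺ (eval-allDegreeZero x) (eval-allDegreeZero y)
    eval-allDegreeZero (x ⊛ y)    = *L-allDegreeZero (eval-allDegreeZero x) (eval-allDegreeZero y)

    generated⇒concentrated : ∀ {f} → InGeneratedSubalgebra R f → ConcentratedInDegreeZero f
    generated⇒concentrated (x , x≈f) e ¬dz =
      ≈-trans (≈-sym (x≈f e)) (coeff-outside-support (eval-allDegreeZero x) ¬dz)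

    coinvariant⇔generated : ∀ f → IsCoinvariant R f ⇔ InGeneratedSubalgebra R f
    coinvariant⇔generated f =
      ⇔.trans (coinvariant⇔concentrated f) (mk⇔ (concentrated⇒generated {f}) (generated⇒concentrated {f}))

proposition3p1 : ∀ {c ℓ} (R : CommutativeRing c ℓ) (p n : ℕ) (pp : Prime p) → 1 ≤ n → IsFpAlgebra R p
    → (f : Laurent R (p ^ n))
    → (IsCoinvariant R {{pow-nonZero pp n}} f → InGeneratedSubalgebra R f)
      × (InGeneratedSubalgebra R f → IsCoinvariant R {{pow-nonZero pp n}} f)
proposition3p1 R p n pp _ _ f = to , from
  where open Equivalence (coinvariant⇔generated R {{pow-nonZero pp n}} f)
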